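{- (Coherence) In the Fitch-style calculus for Intuitionistic S4, interpreted in a cartesian closed category $\mathcal{C}$ with an adjunction $\Diamond\dashv\Box$ in which $\Box$ is an idempotent comonad, any two derivation trees of the same typed term-in-context $\Gamma\vdash t:A$ have equal denotations.
   Context: Calculus: types $A,B ::= p \mid 1 \mid A\times B \mid A\to B \mid \Box A$; contexts $\Gamma ::= \cdot \mid \Gamma,x:A \mid \Gamma,\bullet$ ($\bullet$ a structural symbol called a lock; variables distinct). Rules: (var) $\Gamma,x:A,\Gamma'\vdash x:A$ provided $\Gamma'$ contains no lock; (products) $\Gamma\vdash\langle\rangle:1$, pairing and projections as usual; (functions) $\lambda$-abstraction and application as usual; (shut) from $\Gamma,\bullet\vdash t:A$ infer $\Gamma\vdash\mathrm{shut}\,t:\Box A$; (open) from $\Gamma\vdash t:\Box A$ infer $\Gamma,\Gamma'\vdash\mathrm{open}\,t:A$ for any context $\Gamma'$ (the term does not record $\Gamma'$, so a term may have several derivations). Semantics: $(\Diamond,\eta,\mu)$ is the monad induced by the comonad $\Box$ via the adjunction (unit $\eta^m$, counit $\varepsilon^m$); idempotence means each $\mu_X$ is an isomorphism with inverse $\eta_{\Diamond X}=\Diamond\eta_X$. Types are interpreted via the cartesian closed structure and $\Box$ (atoms by arbitrary objects). A context $\Gamma$ denotes an endofunctor: $[\![\cdot]\!]=\mathrm{Id}$, $[\![\Gamma,x:A]\!](X)=[\![\Gamma]\!](X)\times[\![A]\!]$, $[\![\Gamma,\bullet]\!](X)=\Diamond[\![\Gamma]\!](X)$, and the object $[\![\Gamma]\!]=[\![\Gamma]\!](1)$,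 so $[\![\Gamma,\Gamma']\!]=[\![\Gamma']\!]([\![\Gamma]\!])$. Lock replacement $l_\Gamma:[\![\Gamma]\!]\Rightarrow\Diamond$: $l_\cdot=\eta$, $(l_{\Gamma,x:A})_X=(l_\Gamma)_X\circ\mathrm{pr}$, $(l_{\Gamma,\bullet})_X=\mu_X\circ\Diamond(l_\Gamma)_X$. A derivation $D$ of $\Gamma\vdash t:A$ denotes $[\![D]\!]:[\![\Gamma]\!]\to[\![A]\!]$ by induction on $D$: variables by projections, $1,\times,\to$ by the cartesian closed structure, $[\![\mathrm{shut}\,t]\!]=\Box[\![t]\!]\circ\eta^m_{[\![\Gamma]\!]}$, and $[\![\Gamma,\Gamma'\vdash\mathrm{open}\,t]\!]=\varepsilon^m_{[\![A]\!]}\circ\Diamond[\![t]\!]\circ(l_{\Gamma'})_{[\![\Gamma]\!]}$. -}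

module Defs where

open import Level using (Level; _⊔_) renaming (suc to lsuc)
open import Data.Nat using (ℕ)
open import Data.Unit using (⊤; tt)
open import Data.Product using (Σ; _×_; _,_)
open import Relation.Binary.Core using (Rel)
open import Relation.Binary.Structures using (IsEquivalence)
open import Relation.Binary.PropositionalEquality using (_≢_)

record Model (o ℓ e : Level) : Set (lsuc (o ⊔ ℓ ⊔ e)) where
  infixr 9 _∘_
  infix  4 _≈_
  field
    Obj     : Set o
    Hom     : Obj → Obj → Set ℓ
    _≈_     : ∀ {A B} → Rel (Hom A B) e
    ≈-equiv : ∀ {A B} → IsEquivalence (_≈_ {A} {B})
    id      : ∀ {A} → Hom A A
    _∘_     : ∀ {A B C} → Hom B C → Hom A B → Hom A C
    identityˡ : ∀ {A B} {f : Hom A B} → id ∘ f ≈ f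
    identityʳ : ∀ {A B} {f : Hom A B} → f ∘ id ≈ f
    assoc     : ∀ {A B C D} {f : Hom A B} {g : Hom B C} {h : Hom C D} →
                (h ∘ g) ∘ f ≈ h ∘ (g ∘ f)
    ∘-resp-≈  : ∀ {A B C} {f f′ : Hom B C} {g g′ : Hom A B} →
                f ≈ f′ → g ≈ g′ → f ∘ g ≈ f′ ∘ g′
    ⊤ₒ       : Obj
    !        : ∀ {A} → Hom A ⊤ₒ
    !-unique : ∀ {A} (f : Hom A ⊤ₒ) → f ≈ !
    _×ₒ_     : Obj → Obj → Obj
    π₁       : ∀ {A B} → Hom (A ×ₒ B) A
    π₂       : ∀ {A B} → Hom (A ×ₒ B) B
    ⟨_,_⟩    : ∀ {C A B} → Hom C A → Hom C B → Hom C (A ×ₒ B)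
    π₁-β     : ∀ {C A B} {f : Hom C A} {g : Hom C B} → π₁ ∘ ⟨ f , g ⟩ ≈ f
    π₂-β     : ∀ {C A B} {f : Hom C A} {g : Hom C B} → π₂ ∘ ⟨ f , g ⟩ ≈ g
    ⟨⟩-unique : ∀ {C A B} {f : Hom C A} {g : Hom C B} {h : Hom C (A ×ₒ B)} →
                π₁ ∘ h ≈ f → π₂ ∘ h ≈ g → h ≈ ⟨ f , g ⟩
    _⇨_      : Obj → Obj → Obj
    eval     : ∀ {A B} → Hom ((A ⇨ B) ×ₒ A) B
    curry    : ∀ {C A B} → Hom (C ×ₒ A) B → Hom C (A ⇨ B)
    curry-β  : ∀ {C A B} {f : Hom (C ×ₒ A) B} →
               eval ∘ ⟨ curry f ∘ π₁ , id ∘ π₂ ⟩ ≈ f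
    curry-unique : ∀ {C A B} {f : Hom (C ×ₒ A) B} {h : Hom C (A ⇨ B)} →
               eval ∘ ⟨ h ∘ π₁ , id ∘ π₂ ⟩ ≈ f → h ≈ curry f
    Box      : Obj → Obj
    box₁     : ∀ {A B} → Hom A B → Hom (Box A) (Box B)
    box-id   : ∀ {A} → box₁ (id {A}) ≈ id
    box-∘    : ∀ {A B C} {f : Hom A B} {g : Hom B C} → box₁ (g ∘ f) ≈ box₁ g ∘ box₁ f
    box-resp : ∀ {A B} {f g : Hom A B} → f ≈ g → box₁ f ≈ box₁ g
    Dia      : Obj → Obj
    dia₁     : ∀ {A B} → Hom A B → Hom (Dia A) (Dia B)
    dia-id   : ∀ {A} → dia₁ (id {A}) ≈ id
    dia-∘    : ∀ {A B C} {f : Hom A B} {g : Hom B C} → dia₁ (g ∘ f) ≈ dia₁ g ∘ dia₁ f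
    dia-resp : ∀ {A B} {f g : Hom A B} → f ≈ g → dia₁ f ≈ dia₁ g
    ε        : ∀ A → Hom (Box A) A
    δ        : ∀ A → Hom (Box A) (Box (Box A))
    ε-nat    : ∀ {A B} (f : Hom A B) → ε B ∘ box₁ f ≈ f ∘ ε A
    δ-nat    : ∀ {A B} (f : Hom A B) → δ B ∘ box₁ f ≈ box₁ (box₁ f) ∘ δ A
    comonad-idˡ  : ∀ {A} → ε (Box A) ∘ δ A ≈ id
    comonad-idʳ  : ∀ {A} → box₁ (ε A) ∘ δ A ≈ id
    comonad-assoc : ∀ {A} → δ (Box A) ∘ δ A ≈ box₁ (δ A) ∘ δ A
    ηᵐ       : ∀ A → Hom A (Box (Dia A))
    εᵐ       : ∀ A → Hom (Dia (Box A)) A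
    ηᵐ-nat   : ∀ {A B} (f : Hom A B) → box₁ (dia₁ f) ∘ ηᵐ A ≈ ηᵐ B ∘ f
    εᵐ-nat   : ∀ {A B} (f : Hom A B) → f ∘ εᵐ A ≈ εᵐ B ∘ dia₁ (box₁ f)
    triangle-◇ : ∀ {A} → εᵐ (Dia A) ∘ dia₁ (ηᵐ A) ≈ id
    triangle-□ : ∀ {A} → box₁ (εᵐ A) ∘ ηᵐ (Box A) ≈ id

IdempotentComonad : ∀ {o ℓ e} → Model o ℓ e → Set (o ⊔ ℓ ⊔ e)
IdempotentComonad M =
  ∀ A → Σ (Hom (Box (Box A)) (Box A)) λ g → (g ∘ δ A ≈ id) × (δ A ∘ g ≈ id)
  where open Model M

Name : Set
Name = ℕ

infixr 7 _⊗_
infixr 6 _⇒_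
data Ty : Set where
  ι   : ℕ → Ty
  𝟙   : Ty
  _⊗_ : Ty → Ty → Ty
  _⇒_ : Ty → Ty → Ty
  □_  : Ty → Ty

infixl 5 _,_∶_ _,•
data Ctx : Set where
  ·     : Ctx
  _,_∶_ : Ctx → Name → Ty → Ctx
  _,•   : Ctx → Ctx

_∉_ : Name → Ctx → Set
x ∉ · = ⊤
x ∉ (Γ , y ∶ A) = (x ≢ y) × (x ∉ Γ)
x ∉ (Γ ,•) = x ∉ Γ

Distinct : Ctx → Set
Distinct · = ⊤
Distinct (Γ , x ∶ A) = (x ∉ Γ) × Distinct Γ
Distinct (Γ ,•) = Distinct Γ

data Tm : Set where
  var   : Name → Tm
  unit  : Tm
  pair  : Tm → Tm → Tm
  fst   : Tm → Tm
  snd   : Tm → Tm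
  lam   : Name → Ty → Tm → Tm
  app   : Tm → Tm → Tm
  shut  : Tm → Tm
  open′ : Tm → Tm

-- Γ ∋ x ∶ A : Γ = Γ₀ , x ∶ A , Γ′ with Γ′ containing no lock
data _∋_∶_ : Ctx → Name → Ty → Set where
  here  : ∀ {Γ x A} → (Γ , x ∶ A) ∋ x ∶ A
  there : ∀ {Γ x A y B} → Γ ∋ x ∶ A → (Γ , y ∶ B) ∋ x ∶ A

-- Ext Γ Δ : Δ = Γ , Γ′ for some context Γ′ (the proof records Γ′)
data Ext (Γ : Ctx) : Ctx → Set where
  ext-·    : Ext Γ Γ
  ext-var  : ∀ {Δ x A} → Ext Γ Δ → Ext Γ (Δ , x ∶ A)
  ext-lock : ∀ {Δ} → Ext Γ Δ → Ext Γ (Δ ,•)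

data Der : Ctx → Tm → Ty → Set where
  d-var  : ∀ {Γ x A} → Γ ∋ x ∶ A → Der Γ (var x) A
  d-unit : ∀ {Γ} → Der Γ unit 𝟙
  d-pair : ∀ {Γ t u A B} → Der Γ t A → Der Γ u B → Der Γ (pair t u) (A ⊗ B)
  d-fst  : ∀ {Γ t A B} → Der Γ t (A ⊗ B) → Der Γ (fst t) A
  d-snd  : ∀ {Γ t A B} → Der Γ t (A ⊗ B) → Der Γ (snd t) B
  d-lam  : ∀ {Γ x t A B} → x ∉ Γ → Der (Γ , x ∶ A) t B → Der Γ (lam x A t) (A ⇒ B)
  d-app  : ∀ {Γ t u A B} → Der Γ t (A ⇒ B) → Der Γ u A → Der Γ (app t u) B
  d-shut : ∀ {Γ t A} → Der (Γ ,•) t A → Der Γ (shut t) (□ A)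
  d-open : ∀ {Γ Δ t A} → Ext Γ Δ → Der Γ t (□ A) → Der Δ (open′ t) A

module Sem {o ℓ e} (M : Model o ℓ e) (ρ : ℕ → Model.Obj M) where
  open Model M

  -- monad (◇, η, μ) induced by the comonad □ via the adjunction ◇ ⊣ □
  η : ∀ A → Hom A (Dia A)
  η A = ε (Dia A) ∘ ηᵐ A

  μ : ∀ A → Hom (Dia (Dia A)) (Dia A)
  μ A = εᵐ (Dia A) ∘ dia₁ (εᵐ (Box (Dia A)) ∘ dia₁ (δ (Dia A) ∘ ηᵐ A))

  ⟦_⟧T : Ty → Obj
  ⟦ ι p ⟧T = ρ p
  ⟦ 𝟙 ⟧T = ⊤ₒ
  ⟦ A ⊗ B ⟧T = ⟦ A ⟧T ×ₒ ⟦ B ⟧T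
  ⟦ A ⇒ B ⟧T = ⟦ A ⟧T ⇨ ⟦ B ⟧T
  ⟦ □ A ⟧T = Box ⟦ A ⟧T

  -- a context as an endofunctor (on objects)
  ⟦_⟧F : Ctx → Obj → Obj
  ⟦ · ⟧F X = X
  ⟦ Γ , x ∶ A ⟧F X = ⟦ Γ ⟧F X ×ₒ ⟦ A ⟧T
  ⟦ Γ ,• ⟧F X = Dia (⟦ Γ ⟧F X)

  ⟦_⟧C : Ctx → Obj
  ⟦ Γ ⟧C = ⟦ Γ ⟧F ⊤ₒ

  lock : ∀ {Γ Δ} → Ext Γ Δ → Hom ⟦ Δ ⟧C (Dia ⟦ Γ ⟧C)
  lock {Γ} ext-· = η ⟦ Γ ⟧C
  lock (ext-var e) = lock e ∘ π₁
  lock {Γ} (ext-lock e) = μ ⟦ Γ ⟧C ∘ dia₁ (lock e)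

  ⟦_⟧∋ : ∀ {Γ x A} → Γ ∋ x ∶ A → Hom ⟦ Γ ⟧C ⟦ A ⟧T
  ⟦ here ⟧∋ = π₂
  ⟦ there v ⟧∋ = ⟦ v ⟧∋ ∘ π₁

  ⟦_⟧ : ∀ {Γ t A} → Der Γ t A → Hom ⟦ Γ ⟧C ⟦ A ⟧T
  ⟦ d-var v ⟧ = ⟦ v ⟧∋
  ⟦ d-unit ⟧ = !
  ⟦ d-pair d d′ ⟧ = ⟨ ⟦ d ⟧ , ⟦ d′ ⟧ ⟩
  ⟦ d-fst d ⟧ = π₁ ∘ ⟦ d ⟧
  ⟦ d-snd d ⟧ = π₂ ∘ ⟦ d ⟧
  ⟦ d-lam _ d ⟧ = curry ⟦ d ⟧
  ⟦ d-app d d′ ⟧ = eval ∘ ⟨ ⟦ d ⟧ , ⟦ d′ ⟧ ⟩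
  ⟦ d-shut {Γ} d ⟧ = box₁ ⟦ d ⟧ ∘ ηᵐ ⟦ Γ ⟧C
  ⟦ d-open {A = A} e d ⟧ = εᵐ ⟦ A ⟧T ∘ (dia₁ ⟦ d ⟧ ∘ lock e)

-- Two derivations of the same term can differ only in how each (open) splits its context, so the
-- premises of two matching (open) steps live in different prefixes of the context.  We therefore
-- compare derivations of a term in two overlapping contexts Δ₁ and Δ₂: both denotations factor
-- through the common part of Δ₁ and Δ₂, along weakenings built from projections, η and μ.
-- Idempotence of □ makes μ invertible, and then any two weakenings between the same contexts
-- (with distinct variables) have equal denotations; this absorbs the different choices of lock
-- replacement.  Taking Δ₁ = Δ₂ = Γ gives the theorem.
module Submission where

open import Data.Nat using (ℕ)
open import Data.Unit using (⊤; tt)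
open import Data.Empty using (⊥-elim)
open import Data.Product using (Σ; _×_; _,_; proj₁)
open import Level using (_⊔_)
open import Relation.Nullary using (¬_)
open import Relation.Binary.Bundles using (Setoid)
open import Relation.Binary.Structures using (IsEquivalence)
open import Relation.Binary.PropositionalEquality using (_≡_; refl; sym; cong; subst₂)
import Relation.Binary.Reasoning.Setoid as SetoidReasoning

open import Defs

variable
  Γ Δ Δ₁ Δ₂ Ω Ψ P P₁ P₂ : Ctx
  x : Name
  A B : Ty
  t : Tm

∋⇒¬∉ : Γ ∋ x ∶ A → ¬ (x ∉ Γ)
∋⇒¬∉ here      (x≢x , _) = x≢x refl
∋⇒¬∉ (there v) (_ , x∉Γ) = ∋⇒¬∉ v x∉Γ

∉-Ext : Ext P Δ → x ∉ Δ → x ∉ P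
∉-Ext ext-·        x∉Δ       = x∉Δ
∉-Ext (ext-var e)  (_ , x∉Δ) = ∉-Ext e x∉Δ
∉-Ext (ext-lock e) x∉Δ       = ∉-Ext e x∉Δ

Distinct-Ext : Ext P Δ → Distinct Δ → Distinct P
Distinct-Ext ext-·        dΔ       = dΔ
Distinct-Ext (ext-var e)  (_ , dΔ) = Distinct-Ext e dΔ
Distinct-Ext (ext-lock e) dΔ       = Distinct-Ext e dΔ

-- Wk Δ Ω will denote a map ⟦ Δ ⟧C → ⟦ Ω ⟧C: drop is a projection, add• is η and merge• is μ ∘ ◇;
-- the lock replacements are the weakenings Ext⇒Wk e.
data Wk : Ctx → Ctx → Set where
  base   : Wk · ·
  drop   : Wk Δ Ω → Wk (Δ , x ∶ A) Ω
  keep   : Wk Δ Ω → Wk (Δ , x ∶ A) (Ω , x ∶ A)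
  add•   : Wk Δ Ω → Wk Δ (Ω ,•)
  merge• : Wk Δ (Ω ,•) → Wk (Δ ,•) (Ω ,•)

Wk-refl : ∀ Γ → Wk Γ Γ
Wk-refl ·           = base
Wk-refl (Γ , x ∶ A) = keep (Wk-refl Γ)
Wk-refl (Γ ,•)      = merge• (add• (Wk-refl Γ))

Wk-trans : Wk Δ Ω → Wk Ω Ψ → Wk Δ Ψ
Wk-trans w          base       = w
Wk-trans w          (add• v)   = add• (Wk-trans w v)
Wk-trans (drop w)   (drop v)   = drop (Wk-trans w (drop v))
Wk-trans (keep w)   (drop v)   = drop (Wk-trans w v)
Wk-trans (drop w)   (keep v)   = drop (Wk-trans w (keep v))
Wk-trans (keep w)   (keep v)   = keep (Wk-trans w v)
Wk-trans (drop w)   (merge• v) = drop (Wk-trans w (merge• v))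
Wk-trans (add• w)   (merge• v) = Wk-trans w v
Wk-trans (merge• w) (merge• v) = merge• (Wk-trans w (merge• v))

Ext⇒Wk : Ext Γ Δ → Wk Δ (Γ ,•)
Ext⇒Wk {Γ} ext-·    = add• (Wk-refl Γ)
Ext⇒Wk (ext-var e)  = drop (Ext⇒Wk e)
Ext⇒Wk (ext-lock e) = merge• (Ext⇒Wk e)

∉-Wk : Wk Δ Ω → x ∉ Δ → x ∉ Ω
∉-Wk base       _           = tt
∉-Wk (drop w)   (_ , x∉Δ)   = ∉-Wk w x∉Δ
∉-Wk (keep w)   (x≢y , x∉Δ) = x≢y , ∉-Wk w x∉Δ
∉-Wk (add• w)   x∉Δ         = ∉-Wk w x∉Δ
∉-Wk (merge• w) x∉Δ         = ∉-Wk w x∉Δ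

-- The common part keeps the shared variables and every lock: a side lacking a lock
-- reaches it by add•.
data Overlap : Ctx → Ctx → Set where
  []     : Overlap · ·
  both   : Overlap Δ₁ Δ₂ → Overlap (Δ₁ , x ∶ A) (Δ₂ , x ∶ A)
  left   : Overlap Δ₁ Δ₂ → Overlap (Δ₁ , x ∶ A) Δ₂
  right  : Overlap Δ₁ Δ₂ → Overlap Δ₁ (Δ₂ , x ∶ A)
  both•  : Overlap Δ₁ Δ₂ → Overlap (Δ₁ ,•) (Δ₂ ,•)
  left•  : Overlap Δ₁ Δ₂ → Overlap (Δ₁ ,•) Δ₂
  right• : Overlap Δ₁ Δ₂ → Overlap Δ₁ (Δ₂ ,•)

common : Overlap Δ₁ Δ₂ → Ctx
common []                   = ·
common (both {x = x} {A} j) = common j , x ∶ A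
common (left j)             = common j
common (right j)            = common j
common (both• j)            = common j ,•
common (left• j)            = common j ,•
common (right• j)           = common j ,•

wkˡ : (j : Overlap Δ₁ Δ₂) → Wk Δ₁ (common j)
wkˡ []         = base
wkˡ (both j)   = keep (wkˡ j)
wkˡ (left j)   = drop (wkˡ j)
wkˡ (right j)  = wkˡ j
wkˡ (both• j)  = merge• (add• (wkˡ j))
wkˡ (left• j)  = merge• (add• (wkˡ j))
wkˡ (right• j) = add• (wkˡ j)

wkʳ : (j : Overlap Δ₁ Δ₂) → Wk Δ₂ (common j)
wkʳ []         = base
wkʳ (both j)   = keep (wkʳ j)
wkʳ (left j)   = wkʳ j
wkʳ (right j)  = drop (wkʳ j)
wkʳ (both• j)  = merge• (add• (wkʳ j))
wkʳ (left• j)  = add• (wkʳ j)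
wkʳ (right• j) = merge• (add• (wkʳ j))

Apart : Overlap Δ₁ Δ₂ → Set
Apart []                          = ⊤
Apart (both j)                    = Apart j
Apart {Δ₂ = Δ₂} (left {x = x} j)  = x ∉ Δ₂ × Apart j
Apart {Δ₁ = Δ₁} (right {x = x} j) = x ∉ Δ₁ × Apart j
Apart (both• j)                   = Apart j
Apart (left• j)                   = Apart j
Apart (right• j)                  = Apart j

diagonal : ∀ Γ → Overlap Γ Γ
diagonal ·           = []
diagonal (Γ , x ∶ A) = both (diagonal Γ)
diagonal (Γ ,•)      = both• (diagonal Γ)

Apart-diagonal : ∀ Γ → Apart (diagonal Γ)
Apart-diagonal ·           = tt
Apart-diagonal (Γ , x ∶ A) = Apart-diagonal Γ
Apart-diagonal (Γ ,•)      = Apart-diagonal Γ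

swap : Overlap Δ₁ Δ₂ → Overlap Δ₂ Δ₁
swap []         = []
swap (both j)   = both (swap j)
swap (left j)   = right (swap j)
swap (right j)  = left (swap j)
swap (both• j)  = both• (swap j)
swap (left• j)  = right• (swap j)
swap (right• j) = left• (swap j)

common-swap : (j : Overlap Δ₁ Δ₂) → common (swap j) ≡ common j
common-swap []         = refl
common-swap (both j)   = cong (_, _ ∶ _) (common-swap j)
common-swap (left j)   = common-swap j
common-swap (right j)  = common-swap j
common-swap (both• j)  = cong _,• (common-swap j)
common-swap (left• j)  = cong _,• (common-swap j)
common-swap (right• j) = cong _,• (common-swap j)

Apart-swap : (j : Overlap Δ₁ Δ₂) → Apart j → Apart (swap j)
Apart-swap []         _         = tt
Apart-swap (both j)   a         = Apart-swap j a
Apart-swap (left j)   (x∉ , a)  = x∉ , Apart-swap j a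
Apart-swap (right j)  (x∉ , a)  = x∉ , Apart-swap j a
Apart-swap (both• j)  a         = Apart-swap j a
Apart-swap (left• j)  a         = Apart-swap j a
Apart-swap (right• j) a         = Apart-swap j a

Restriction : Overlap Δ₁ Δ₂ → Ctx → Ctx → Set
Restriction j P₁ P₂ = Σ (Overlap P₁ P₂) λ j′ → Apart j′ × Wk (common j) (common j′ ,•)

restrictˡ : (j : Overlap Δ₁ Δ₂) → Apart j → Distinct Δ₁ → Ext P Δ₁ → Restriction j P Δ₂
restrictˡ j a _ ext-· = j , a , add• (Wk-refl _)
restrictˡ (both j) a (x∉Δ₁ , dΔ₁) (ext-var e) =
  let j′ , a′ , w = restrictˡ j a dΔ₁ e in right j′ , (∉-Ext e x∉Δ₁ , a′) , drop w
restrictˡ (left j) (_ , a) (_ , dΔ₁) (ext-var e) = restrictˡ j a dΔ₁ e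
restrictˡ (right j) (x∉Δ₁ , a) dΔ₁ e =
  let j′ , a′ , w = restrictˡ j a dΔ₁ e in right j′ , (∉-Ext e x∉Δ₁ , a′) , w
restrictˡ (both• j) a dΔ₁ (ext-lock e) =
  let j′ , a′ , w = restrictˡ j a dΔ₁ e in right• j′ , a′ , merge• (add• w)
restrictˡ (left• j) a dΔ₁ (ext-lock e) =
  let j′ , a′ , w = restrictˡ j a dΔ₁ e in j′ , a′ , merge• w
restrictˡ (right• j) a dΔ₁ e =
  let j′ , a′ , w = restrictˡ j a dΔ₁ e in right• j′ , a′ , merge• (add• w)

restrictʳ : (j : Overlap Δ₁ Δ₂) → Apart j → Distinct Δ₂ → Ext P Δ₂ → Restriction j Δ₁ P
restrictʳ j a dΔ₂ e =
  let j′ , a′ , w = restrictˡ (swap j) (Apart-swap j a) dΔ₂ e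
  in swap j′ , Apart-swap j′ a′ , subst₂ Wk (common-swap j) (cong _,• (sym (common-swap j′))) w

restrict : (j : Overlap Δ₁ Δ₂) → Apart j → Distinct Δ₁ → Distinct Δ₂ →
           Ext P₁ Δ₁ → Ext P₂ Δ₂ → Restriction j P₁ P₂
restrict j a dΔ₁ dΔ₂ e₁ e₂ =
  let jˡ , aˡ , wˡ = restrictˡ j a dΔ₁ e₁
      j′ , a′ , wʳ = restrictʳ jˡ aˡ dΔ₂ e₂
  in j′ , a′ , Wk-trans wˡ (merge• wʳ)

∋-type-unique : (j : Overlap Δ₁ Δ₂) → Apart j → Distinct Δ₁ → Distinct Δ₂ →
                Δ₁ ∋ x ∶ A → Δ₂ ∋ x ∶ B → A ≡ B
∋-type-unique (both j) _ _ _ here here = refl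
∋-type-unique (both j) _ _ (x∉Δ₂ , _) here (there v₂) = ⊥-elim (∋⇒¬∉ v₂ x∉Δ₂)
∋-type-unique (both j) _ (x∉Δ₁ , _) _ (there v₁) here = ⊥-elim (∋⇒¬∉ v₁ x∉Δ₁)
∋-type-unique (both j) a (_ , dΔ₁) (_ , dΔ₂) (there v₁) (there v₂) =
  ∋-type-unique j a dΔ₁ dΔ₂ v₁ v₂
∋-type-unique (left j) (x∉Δ₂ , _) _ _ here v₂ = ⊥-elim (∋⇒¬∉ v₂ x∉Δ₂)
∋-type-unique (left j) (_ , a) (_ , dΔ₁) dΔ₂ (there v₁) v₂ =
  ∋-type-unique j a dΔ₁ dΔ₂ v₁ v₂
∋-type-unique (right j) (x∉Δ₁ , _) _ _ v₁ here = ⊥-elim (∋⇒¬∉ v₁ x∉Δ₁)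
∋-type-unique (right j) (_ , a) dΔ₁ (_ , dΔ₂) v₁ (there v₂) =
  ∋-type-unique j a dΔ₁ dΔ₂ v₁ v₂

Der-type-unique : (j : Overlap Δ₁ Δ₂) → Apart j → Distinct Δ₁ → Distinct Δ₂ →
                  Der Δ₁ t A → Der Δ₂ t B → A ≡ B
Der-type-unique j a dΔ₁ dΔ₂ (d-var v₁) (d-var v₂) = ∋-type-unique j a dΔ₁ dΔ₂ v₁ v₂
Der-type-unique j a dΔ₁ dΔ₂ d-unit d-unit = refl
Der-type-unique j a dΔ₁ dΔ₂ (d-pair s₁ t₁) (d-pair s₂ t₂)
  with refl ← Der-type-unique j a dΔ₁ dΔ₂ s₁ s₂ | refl ← Der-type-unique j a dΔ₁ dΔ₂ t₁ t₂ = refl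
Der-type-unique j a dΔ₁ dΔ₂ (d-fst t₁) (d-fst t₂)
  with refl ← Der-type-unique j a dΔ₁ dΔ₂ t₁ t₂ = refl
Der-type-unique j a dΔ₁ dΔ₂ (d-snd t₁) (d-snd t₂)
  with refl ← Der-type-unique j a dΔ₁ dΔ₂ t₁ t₂ = refl
Der-type-unique j a dΔ₁ dΔ₂ (d-lam x∉Δ₁ t₁) (d-lam x∉Δ₂ t₂)
  with refl ← Der-type-unique (both j) a (x∉Δ₁ , dΔ₁) (x∉Δ₂ , dΔ₂) t₁ t₂ = refl
Der-type-unique j a dΔ₁ dΔ₂ (d-app s₁ _) (d-app s₂ _)
  with refl ← Der-type-unique j a dΔ₁ dΔ₂ s₁ s₂ = refl
Der-type-unique j a dΔ₁ dΔ₂ (d-shut t₁) (d-shut t₂)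
  with refl ← Der-type-unique (both• j) a dΔ₁ dΔ₂ t₁ t₂ = refl
Der-type-unique j a dΔ₁ dΔ₂ (d-open e₁ t₁) (d-open e₂ t₂)
  with j′ , a′ , _ ← restrict j a dΔ₁ dΔ₂ e₁ e₂
  with refl ← Der-type-unique j′ a′ (Distinct-Ext e₁ dΔ₁) (Distinct-Ext e₂ dΔ₂) t₁ t₂ = refl

module Coherence {o ℓ e} (M : Model o ℓ e) (idem : IdempotentComonad M) (ρ : ℕ → Model.Obj M) where
  open Model M
  open Sem M ρ

  module ≈ {X Y} = IsEquivalence (≈-equiv {X} {Y})

  hom-setoid : Obj → Obj → Setoid ℓ e
  hom-setoid X Y = record { Carrier = Hom X Y ; _≈_ = _≈_ ; isEquivalence = ≈-equiv }

  open module HomReasoning {X Y} = SetoidReasoning (hom-setoid X Y)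

  variable
    X Y Z W : Obj

  ∘-resp-≈ˡ : {f f′ : Hom Y Z} {g : Hom X Y} → f ≈ f′ → f ∘ g ≈ f′ ∘ g
  ∘-resp-≈ˡ p = ∘-resp-≈ p ≈.refl

  ∘-resp-≈ʳ : {f : Hom Y Z} {g g′ : Hom X Y} → g ≈ g′ → f ∘ g ≈ f ∘ g′
  ∘-resp-≈ʳ p = ∘-resp-≈ ≈.refl p

  ⟨⟩-cong : {f f′ : Hom X Y} {g g′ : Hom X Z} → f ≈ f′ → g ≈ g′ → ⟨ f , g ⟩ ≈ ⟨ f′ , g′ ⟩
  ⟨⟩-cong p q = ⟨⟩-unique (≈.trans π₁-β p) (≈.trans π₂-β q)

  ⟨⟩∘ : {f : Hom X Y} {g : Hom X Z} {h : Hom W X} → ⟨ f , g ⟩ ∘ h ≈ ⟨ f ∘ h , g ∘ h ⟩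
  ⟨⟩∘ = ⟨⟩-unique (≈.trans (≈.sym assoc) (∘-resp-≈ˡ π₁-β))
                  (≈.trans (≈.sym assoc) (∘-resp-≈ˡ π₂-β))

  ⟨π₁,π₂⟩≈id : ⟨ π₁ , π₂ ⟩ ≈ id {X ×ₒ Y}
  ⟨π₁,π₂⟩≈id = ≈.sym (⟨⟩-unique identityʳ identityʳ)

  drop-through : {f : Hom X Z} {h : Hom Y Z} {u : Hom X Y} → f ≈ h ∘ u →
                 f ∘ π₁ {X} {W} ≈ h ∘ (u ∘ π₁)
  drop-through p = ≈.trans (∘-resp-≈ˡ p) assoc

  keep-through : {f : Hom X Z} {h : Hom Y Z} {u : Hom X Y} → f ≈ h ∘ u →
                 f ∘ π₁ {X} {W} ≈ (h ∘ π₁) ∘ ⟨ u ∘ π₁ , π₂ ⟩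
  keep-through p = ≈.trans (drop-through p) (≈.trans (∘-resp-≈ʳ (≈.sym π₁-β)) (≈.sym assoc))

  curry-cong : {f g : Hom (X ×ₒ Y) Z} → f ≈ g → curry f ≈ curry g
  curry-cong p = curry-unique (≈.trans curry-β p)

  curry-∘ : {f : Hom (X ×ₒ Y) Z} {h : Hom W X} → curry f ∘ h ≈ curry (f ∘ ⟨ h ∘ π₁ , π₂ ⟩)
  curry-∘ {f = f} {h} = curry-unique (begin
    eval ∘ ⟨ (curry f ∘ h) ∘ π₁ , id ∘ π₂ ⟩
      ≈⟨ ∘-resp-≈ʳ (⟨⟩-cong (≈.trans assoc (≈.trans (∘-resp-≈ʳ π₁-β) (≈.sym assoc)))
                            (≈.trans assoc (∘-resp-≈ʳ π₂-β))) ⟨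
    eval ∘ ⟨ (curry f ∘ π₁) ∘ ⟨ h ∘ π₁ , π₂ ⟩ , (id ∘ π₂) ∘ ⟨ h ∘ π₁ , π₂ ⟩ ⟩
      ≈⟨ ∘-resp-≈ʳ ⟨⟩∘ ⟨
    eval ∘ (⟨ curry f ∘ π₁ , id ∘ π₂ ⟩ ∘ ⟨ h ∘ π₁ , π₂ ⟩)
      ≈⟨ ≈.trans (≈.sym assoc) (∘-resp-≈ˡ curry-β) ⟩
    f ∘ ⟨ h ∘ π₁ , π₂ ⟩ ∎)

  Ladjunct : Hom (Dia X) Y → Hom X (Box Y)
  Ladjunct {X} f = box₁ f ∘ ηᵐ X

  Radjunct : Hom X (Box Y) → Hom (Dia X) Y
  Radjunct {Y = Y} g = εᵐ Y ∘ dia₁ g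

  LRadjunct≈id : (g : Hom X (Box Y)) → Ladjunct (Radjunct g) ≈ g
  LRadjunct≈id {X} {Y} g = begin
    box₁ (εᵐ Y ∘ dia₁ g) ∘ ηᵐ X           ≈⟨ ∘-resp-≈ˡ box-∘ ⟩
    (box₁ (εᵐ Y) ∘ box₁ (dia₁ g)) ∘ ηᵐ X  ≈⟨ assoc ⟩
    box₁ (εᵐ Y) ∘ (box₁ (dia₁ g) ∘ ηᵐ X)  ≈⟨ ∘-resp-≈ʳ (ηᵐ-nat g) ⟩
    box₁ (εᵐ Y) ∘ (ηᵐ (Box Y) ∘ g)        ≈⟨ assoc ⟨
    (box₁ (εᵐ Y) ∘ ηᵐ (Box Y)) ∘ g        ≈⟨ ∘-resp-≈ˡ triangle-□ ⟩
    id ∘ g                                ≈⟨ identityˡ ⟩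
    g                                     ∎

  RLadjunct≈id : (f : Hom (Dia X) Y) → Radjunct (Ladjunct f) ≈ f
  RLadjunct≈id {X} {Y} f = begin
    εᵐ Y ∘ dia₁ (box₁ f ∘ ηᵐ X)           ≈⟨ ∘-resp-≈ʳ dia-∘ ⟩
    εᵐ Y ∘ (dia₁ (box₁ f) ∘ dia₁ (ηᵐ X))  ≈⟨ assoc ⟨
    (εᵐ Y ∘ dia₁ (box₁ f)) ∘ dia₁ (ηᵐ X)  ≈⟨ ∘-resp-≈ˡ (εᵐ-nat f) ⟨
    (f ∘ εᵐ (Dia X)) ∘ dia₁ (ηᵐ X)        ≈⟨ assoc ⟩
    f ∘ (εᵐ (Dia X) ∘ dia₁ (ηᵐ X))        ≈⟨ ∘-resp-≈ʳ triangle-◇ ⟩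
    f ∘ id                                ≈⟨ identityʳ ⟩
    f                                     ∎

  Ladjunct-injective : {f g : Hom (Dia X) Y} → Ladjunct f ≈ Ladjunct g → f ≈ g
  Ladjunct-injective {f = f} {g} p = begin
    f  ≈⟨ RLadjunct≈id f ⟨
    Radjunct (Ladjunct f) ≈⟨ ∘-resp-≈ʳ (dia-resp p) ⟩
    Radjunct (Ladjunct g) ≈⟨ RLadjunct≈id g ⟩
    g  ∎

  -- The idempotent monad ◇

  ∘η≈ε∘Ladjunct : (f : Hom (Dia X) Y) → f ∘ η X ≈ ε Y ∘ Ladjunct f
  ∘η≈ε∘Ladjunct f = ≈.trans (≈.sym assoc) (≈.trans (∘-resp-≈ˡ (≈.sym (ε-nat f))) assoc)

  η-natural : (f : Hom X Y) → dia₁ f ∘ η X ≈ η Y ∘ f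
  η-natural {X} {Y} f = begin
    dia₁ f ∘ η X            ≈⟨ ∘η≈ε∘Ladjunct (dia₁ f) ⟩
    ε (Dia Y) ∘ (box₁ (dia₁ f) ∘ ηᵐ X) ≈⟨ ∘-resp-≈ʳ (ηᵐ-nat f) ⟩
    ε (Dia Y) ∘ (ηᵐ Y ∘ f)  ≈⟨ assoc ⟨
    η Y ∘ f                 ∎

  -- μ X is Radjunct (κ X) by definition.
  κ : ∀ X → Hom (Dia X) (Box (Dia X))
  κ X = Radjunct (δ (Dia X) ∘ ηᵐ X)

  κ∘η≈ηᵐ : ∀ X → κ X ∘ η X ≈ ηᵐ X
  κ∘η≈ηᵐ X = begin
    κ X ∘ η X                             ≈⟨ ∘η≈ε∘Ladjunct (κ X) ⟩
    ε (Box (Dia X)) ∘ Ladjunct (κ X)      ≈⟨ ∘-resp-≈ʳ (LRadjunct≈id _) ⟩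
    ε (Box (Dia X)) ∘ (δ (Dia X) ∘ ηᵐ X)  ≈⟨ assoc ⟨
    (ε (Box (Dia X)) ∘ δ (Dia X)) ∘ ηᵐ X  ≈⟨ ∘-resp-≈ˡ comonad-idˡ ⟩
    id ∘ ηᵐ X                             ≈⟨ identityˡ ⟩
    ηᵐ X                                  ∎

  ε∘κ≈id : ∀ X → ε (Dia X) ∘ κ X ≈ id
  ε∘κ≈id X = begin
    ε (Dia X) ∘ (εᵐ (Box (Dia X)) ∘ dia₁ (δ (Dia X) ∘ ηᵐ X))  ≈⟨ assoc ⟨
    (ε (Dia X) ∘ εᵐ (Box (Dia X))) ∘ dia₁ (δ (Dia X) ∘ ηᵐ X)  ≈⟨ ∘-resp-≈ˡ (εᵐ-nat (ε (Dia X))) ⟩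
    (εᵐ (Dia X) ∘ dia₁ (box₁ (ε (Dia X)))) ∘ dia₁ (δ (Dia X) ∘ ηᵐ X)
      ≈⟨ ≈.trans assoc (∘-resp-≈ʳ (≈.sym dia-∘)) ⟩
    εᵐ (Dia X) ∘ dia₁ (box₁ (ε (Dia X)) ∘ (δ (Dia X) ∘ ηᵐ X))
      ≈⟨ ∘-resp-≈ʳ (dia-resp (≈.trans (≈.sym assoc) (≈.trans (∘-resp-≈ˡ comonad-idʳ) identityˡ))) ⟩
    εᵐ (Dia X) ∘ dia₁ (ηᵐ X)                                  ≈⟨ triangle-◇ ⟩
    id                                                        ∎

  μ∘◇η≈id : ∀ X → μ X ∘ dia₁ (η X) ≈ id
  μ∘◇η≈id X = begin
    (εᵐ (Dia X) ∘ dia₁ (κ X)) ∘ dia₁ (η X)  ≈⟨ ≈.trans assoc (∘-resp-≈ʳ (≈.sym dia-∘)) ⟩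
    εᵐ (Dia X) ∘ dia₁ (κ X ∘ η X)           ≈⟨ ∘-resp-≈ʳ (dia-resp (κ∘η≈ηᵐ X)) ⟩
    εᵐ (Dia X) ∘ dia₁ (ηᵐ X)                ≈⟨ triangle-◇ ⟩
    id                                      ∎

  μ∘η≈id : ∀ X → μ X ∘ η (Dia X) ≈ id
  μ∘η≈id X = begin
    μ X ∘ η (Dia X)             ≈⟨ ∘η≈ε∘Ladjunct (μ X) ⟩
    ε (Dia X) ∘ Ladjunct (μ X)  ≈⟨ ∘-resp-≈ʳ (LRadjunct≈id (κ X)) ⟩
    ε (Dia X) ∘ κ X             ≈⟨ ε∘κ≈id X ⟩
    id                          ∎

  ε□≈□ε : ∀ X → ε (Box X) ≈ box₁ (ε X)
  ε□≈□ε X = let δ⁻¹ , _ , δ∘δ⁻¹≈id = idem X in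
    ≈.trans (left-inverse≈δ⁻¹ δ∘δ⁻¹≈id comonad-idˡ) (≈.sym (left-inverse≈δ⁻¹ δ∘δ⁻¹≈id comonad-idʳ))
    where
    left-inverse≈δ⁻¹ : {δ⁻¹ f : Hom (Box (Box X)) (Box X)} → δ X ∘ δ⁻¹ ≈ id → f ∘ δ X ≈ id → f ≈ δ⁻¹
    left-inverse≈δ⁻¹ {δ⁻¹} {f} δ∘δ⁻¹≈id f∘δ≈id = begin
      f                ≈⟨ identityʳ ⟨
      f ∘ id           ≈⟨ ∘-resp-≈ʳ δ∘δ⁻¹≈id ⟨
      f ∘ (δ X ∘ δ⁻¹)  ≈⟨ assoc ⟨
      (f ∘ δ X) ∘ δ⁻¹  ≈⟨ ∘-resp-≈ˡ f∘δ≈id ⟩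
      id ∘ δ⁻¹         ≈⟨ identityˡ ⟩
      δ⁻¹              ∎

  ◇η≈η◇ : ∀ X → dia₁ (η X) ≈ η (Dia X)
  ◇η≈η◇ X = Ladjunct-injective (begin
    box₁ (dia₁ (η X)) ∘ ηᵐ X                             ≈⟨ ηᵐ-nat (η X) ⟩
    ηᵐ (Dia X) ∘ (ε (Dia X) ∘ ηᵐ X)                      ≈⟨ assoc ⟨
    (ηᵐ (Dia X) ∘ ε (Dia X)) ∘ ηᵐ X                      ≈⟨ ∘-resp-≈ˡ (ε-nat (ηᵐ (Dia X))) ⟨
    (ε (Box (Dia (Dia X))) ∘ box₁ (ηᵐ (Dia X))) ∘ ηᵐ X   ≈⟨ ∘-resp-≈ˡ (∘-resp-≈ˡ (ε□≈□ε (Dia (Dia X)))) ⟩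
    (box₁ (ε (Dia (Dia X))) ∘ box₁ (ηᵐ (Dia X))) ∘ ηᵐ X  ≈⟨ ∘-resp-≈ˡ box-∘ ⟨
    box₁ (η (Dia X)) ∘ ηᵐ X                              ∎)

  η∘μ≈id : ∀ X → η (Dia X) ∘ μ X ≈ id
  η∘μ≈id X = begin
    η (Dia X) ∘ μ X                ≈⟨ η-natural (μ X) ⟨
    dia₁ (μ X) ∘ η (Dia (Dia X))   ≈⟨ ∘-resp-≈ʳ (◇η≈η◇ (Dia X)) ⟨
    dia₁ (μ X) ∘ dia₁ (η (Dia X))  ≈⟨ dia-∘ ⟨
    dia₁ (μ X ∘ η (Dia X))         ≈⟨ dia-resp (μ∘η≈id X) ⟩
    dia₁ id                        ≈⟨ dia-id ⟩
    id                             ∎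

  μ-natural : (f : Hom X Y) → dia₁ f ∘ μ X ≈ μ Y ∘ dia₁ (dia₁ f)
  μ-natural {X} {Y} f = begin
    dia₁ f ∘ μ X                               ≈⟨ identityˡ ⟨
    id ∘ (dia₁ f ∘ μ X)                        ≈⟨ ∘-resp-≈ˡ (μ∘η≈id Y) ⟨
    (μ Y ∘ η (Dia Y)) ∘ (dia₁ f ∘ μ X)         ≈⟨ ≈.trans assoc (∘-resp-≈ʳ (≈.sym assoc)) ⟩
    μ Y ∘ ((η (Dia Y) ∘ dia₁ f) ∘ μ X)         ≈⟨ ∘-resp-≈ʳ (∘-resp-≈ˡ (η-natural (dia₁ f))) ⟨
    μ Y ∘ ((dia₁ (dia₁ f) ∘ η (Dia X)) ∘ μ X)  ≈⟨ ∘-resp-≈ʳ assoc ⟩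
    μ Y ∘ (dia₁ (dia₁ f) ∘ (η (Dia X) ∘ μ X))  ≈⟨ ∘-resp-≈ʳ (≈.trans (∘-resp-≈ʳ (η∘μ≈id X)) identityʳ) ⟩
    μ Y ∘ dia₁ (dia₁ f)                        ∎

  μ-assoc : ∀ X → μ X ∘ dia₁ (μ X) ≈ μ X ∘ μ (Dia X)
  μ-assoc X = begin
    μ X ∘ dia₁ (μ X)                                    ≈⟨ identityʳ ⟨
    (μ X ∘ dia₁ (μ X)) ∘ id                             ≈⟨ ∘-resp-≈ʳ (η∘μ≈id (Dia X)) ⟨
    (μ X ∘ dia₁ (μ X)) ∘ (η (Dia (Dia X)) ∘ μ (Dia X))  ≈⟨ ≈.trans assoc (∘-resp-≈ʳ (≈.sym assoc)) ⟩
    μ X ∘ ((dia₁ (μ X) ∘ η (Dia (Dia X))) ∘ μ (Dia X))  ≈⟨ ∘-resp-≈ʳ (∘-resp-≈ˡ (η-natural (μ X))) ⟩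
    μ X ∘ ((η (Dia X) ∘ μ X) ∘ μ (Dia X))               ≈⟨ ≈.trans (∘-resp-≈ʳ assoc) (≈.sym assoc) ⟩
    (μ X ∘ η (Dia X)) ∘ (μ X ∘ μ (Dia X))               ≈⟨ ≈.trans (∘-resp-≈ˡ (μ∘η≈id X)) identityˡ ⟩
    μ X ∘ μ (Dia X)                                     ∎

  ⟦_⟧ʷ : Wk Δ Ω → Hom ⟦ Δ ⟧C ⟦ Ω ⟧C
  ⟦ base ⟧ʷ               = id
  ⟦ drop w ⟧ʷ             = ⟦ w ⟧ʷ ∘ π₁
  ⟦ keep w ⟧ʷ             = ⟨ ⟦ w ⟧ʷ ∘ π₁ , π₂ ⟩
  ⟦ add• {Ω = Ω} w ⟧ʷ     = η ⟦ Ω ⟧C ∘ ⟦ w ⟧ʷ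
  ⟦ merge• {Ω = Ω} w ⟧ʷ   = μ ⟦ Ω ⟧C ∘ dia₁ ⟦ w ⟧ʷ

  ⟦merge•-add•⟧ : (w : Wk Δ Ω) → ⟦ merge• (add• w) ⟧ʷ ≈ dia₁ ⟦ w ⟧ʷ
  ⟦merge•-add•⟧ {Ω = Ω} w = begin
    μ ⟦ Ω ⟧C ∘ dia₁ (η ⟦ Ω ⟧C ∘ ⟦ w ⟧ʷ)         ≈⟨ ≈.trans (∘-resp-≈ʳ dia-∘) (≈.sym assoc) ⟩
    (μ ⟦ Ω ⟧C ∘ dia₁ (η ⟦ Ω ⟧C)) ∘ dia₁ ⟦ w ⟧ʷ  ≈⟨ ∘-resp-≈ˡ (μ∘◇η≈id _) ⟩
    id ∘ dia₁ ⟦ w ⟧ʷ                            ≈⟨ identityˡ ⟩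
    dia₁ ⟦ w ⟧ʷ                                 ∎

  ⟦Wk-refl⟧ : ∀ Γ → ⟦ Wk-refl Γ ⟧ʷ ≈ id
  ⟦Wk-refl⟧ ·           = ≈.refl
  ⟦Wk-refl⟧ (Γ , x ∶ A) =
    ≈.trans (⟨⟩-cong (≈.trans (∘-resp-≈ˡ (⟦Wk-refl⟧ Γ)) identityˡ) ≈.refl) ⟨π₁,π₂⟩≈id
  ⟦Wk-refl⟧ (Γ ,•)      =
    ≈.trans (⟦merge•-add•⟧ (Wk-refl Γ)) (≈.trans (dia-resp (⟦Wk-refl⟧ Γ)) dia-id)

  ⟦Ext⇒Wk⟧ : (e : Ext Γ Δ) → ⟦ Ext⇒Wk e ⟧ʷ ≈ lock e
  ⟦Ext⇒Wk⟧ {Γ} ext-·   = ≈.trans (∘-resp-≈ʳ (⟦Wk-refl⟧ Γ)) identityʳ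
  ⟦Ext⇒Wk⟧ (ext-var e)  = ∘-resp-≈ˡ (⟦Ext⇒Wk⟧ e)
  ⟦Ext⇒Wk⟧ (ext-lock e) = ∘-resp-≈ʳ (dia-resp (⟦Ext⇒Wk⟧ e))

  ⟦Wk-trans⟧ : (w : Wk Δ Ω) (v : Wk Ω Ψ) → ⟦ Wk-trans w v ⟧ʷ ≈ ⟦ v ⟧ʷ ∘ ⟦ w ⟧ʷ
  ⟦Wk-trans⟧ w        base       = ≈.sym identityˡ
  ⟦Wk-trans⟧ w        (add• v)   = ≈.trans (∘-resp-≈ʳ (⟦Wk-trans⟧ w v)) (≈.sym assoc)
  ⟦Wk-trans⟧ (drop w) (drop v)   = drop-through (⟦Wk-trans⟧ w (drop v))
  ⟦Wk-trans⟧ (keep w) (drop v)   = keep-through (⟦Wk-trans⟧ w v)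
  ⟦Wk-trans⟧ (drop w) (keep v)   = drop-through (⟦Wk-trans⟧ w (keep v))
  ⟦Wk-trans⟧ (keep w) (keep v)   =
    ≈.trans (⟨⟩-cong (keep-through (⟦Wk-trans⟧ w v)) (≈.sym π₂-β)) (≈.sym ⟨⟩∘)
  ⟦Wk-trans⟧ (drop w) (merge• v) = drop-through (⟦Wk-trans⟧ w (merge• v))
  ⟦Wk-trans⟧ {Ψ = Ψ ,•} (add• {Ω = Ω} w) (merge• v) = begin
    ⟦ Wk-trans w v ⟧ʷ                                ≈⟨ ⟦Wk-trans⟧ w v ⟩
    ⟦ v ⟧ʷ ∘ ⟦ w ⟧ʷ                                  ≈⟨ identityˡ ⟨
    id ∘ (⟦ v ⟧ʷ ∘ ⟦ w ⟧ʷ)                           ≈⟨ ∘-resp-≈ˡ (μ∘η≈id _) ⟨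
    (μ ⟦ Ψ ⟧C ∘ η (Dia ⟦ Ψ ⟧C)) ∘ (⟦ v ⟧ʷ ∘ ⟦ w ⟧ʷ)  ≈⟨ ≈.trans assoc (∘-resp-≈ʳ (≈.sym assoc)) ⟩
    μ ⟦ Ψ ⟧C ∘ ((η (Dia ⟦ Ψ ⟧C) ∘ ⟦ v ⟧ʷ) ∘ ⟦ w ⟧ʷ)  ≈⟨ ∘-resp-≈ʳ (∘-resp-≈ˡ (η-natural _)) ⟨
    μ ⟦ Ψ ⟧C ∘ ((dia₁ ⟦ v ⟧ʷ ∘ η ⟦ Ω ⟧C) ∘ ⟦ w ⟧ʷ)   ≈⟨ ≈.trans (∘-resp-≈ʳ assoc) (≈.sym assoc) ⟩
    (μ ⟦ Ψ ⟧C ∘ dia₁ ⟦ v ⟧ʷ) ∘ (η ⟦ Ω ⟧C ∘ ⟦ w ⟧ʷ)   ∎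
  ⟦Wk-trans⟧ {Ψ = Ψ ,•} (merge• {Ω = Ω} w) (merge• v) = begin
    μ ⟦ Ψ ⟧C ∘ dia₁ ⟦ Wk-trans w (merge• v) ⟧ʷ
      ≈⟨ ∘-resp-≈ʳ (dia-resp (⟦Wk-trans⟧ w (merge• v))) ⟩
    μ ⟦ Ψ ⟧C ∘ dia₁ ((μ ⟦ Ψ ⟧C ∘ dia₁ ⟦ v ⟧ʷ) ∘ ⟦ w ⟧ʷ)
      ≈⟨ ∘-resp-≈ʳ (≈.trans dia-∘ (≈.trans (∘-resp-≈ˡ dia-∘) assoc)) ⟩
    μ ⟦ Ψ ⟧C ∘ (dia₁ (μ ⟦ Ψ ⟧C) ∘ (dia₁ (dia₁ ⟦ v ⟧ʷ) ∘ dia₁ ⟦ w ⟧ʷ))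
      ≈⟨ ≈.trans (≈.sym assoc) (≈.trans (∘-resp-≈ˡ (μ-assoc _)) assoc) ⟩
    μ ⟦ Ψ ⟧C ∘ (μ (Dia ⟦ Ψ ⟧C) ∘ (dia₁ (dia₁ ⟦ v ⟧ʷ) ∘ dia₁ ⟦ w ⟧ʷ))
      ≈⟨ ∘-resp-≈ʳ (≈.trans (≈.sym assoc) (∘-resp-≈ˡ (≈.sym (μ-natural _)))) ⟩
    μ ⟦ Ψ ⟧C ∘ ((dia₁ ⟦ v ⟧ʷ ∘ μ ⟦ Ω ⟧C) ∘ dia₁ ⟦ w ⟧ʷ)
      ≈⟨ ≈.trans (∘-resp-≈ʳ assoc) (≈.sym assoc) ⟩
    (μ ⟦ Ψ ⟧C ∘ dia₁ ⟦ v ⟧ʷ) ∘ (μ ⟦ Ω ⟧C ∘ dia₁ ⟦ w ⟧ʷ)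
      ∎

  strengthen : (w : Wk (Δ , x ∶ A) Ω) → x ∉ Ω → Σ (Wk Δ Ω) λ w′ → ⟦ w ⟧ʷ ≈ ⟦ w′ ⟧ʷ ∘ π₁
  strengthen (drop w) _         = w , ≈.refl
  strengthen (keep w) (x≢x , _) = ⊥-elim (x≢x refl)
  strengthen (add• w) x∉Ω       =
    let w′ , p = strengthen w x∉Ω in add• w′ , ≈.trans (∘-resp-≈ʳ p) (≈.sym assoc)

  merge•-normal : (w : Wk (Δ ,•) (Ω ,•)) → Σ (Wk Δ (Ω ,•)) λ v → ⟦ w ⟧ʷ ≈ ⟦ merge• v ⟧ʷ
  merge•-normal (merge• v) = v , ≈.refl
  merge•-normal {Ω = Ω ,•} (add• w) = let v , p = merge•-normal w in add• v , (begin
    η (Dia ⟦ Ω ⟧C) ∘ ⟦ w ⟧ʷ                    ≈⟨ ∘-resp-≈ʳ p ⟩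
    η (Dia ⟦ Ω ⟧C) ∘ (μ ⟦ Ω ⟧C ∘ dia₁ ⟦ v ⟧ʷ)  ≈⟨ assoc ⟨
    (η (Dia ⟦ Ω ⟧C) ∘ μ ⟦ Ω ⟧C) ∘ dia₁ ⟦ v ⟧ʷ  ≈⟨ ≈.trans (∘-resp-≈ˡ (η∘μ≈id _)) identityˡ ⟩
    dia₁ ⟦ v ⟧ʷ                                ≈⟨ ⟦merge•-add•⟧ v ⟨
    ⟦ merge• (add• v) ⟧ʷ                       ∎)

  Wk-coherent : Distinct Δ → (w w′ : Wk Δ Ω) → ⟦ w ⟧ʷ ≈ ⟦ w′ ⟧ʷ
  drop≈add• : Distinct Δ → x ∉ Δ → (w : Wk Δ (Ω ,•)) (w′ : Wk (Δ , x ∶ A) Ω) →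
              ⟦ drop {x = x} {A = A} w ⟧ʷ ≈ ⟦ add• w′ ⟧ʷ

  Wk-coherent {·} _ base base = ≈.refl
  Wk-coherent {·} dΔ (add• w) (add• w′) = ∘-resp-≈ʳ (Wk-coherent dΔ w w′)
  Wk-coherent {Δ , _ ∶ _} (_ , dΔ) (drop w) (drop w′) = ∘-resp-≈ˡ (Wk-coherent dΔ w w′)
  Wk-coherent {Δ , _ ∶ _} (_ , dΔ) (keep w) (keep w′) =
    ⟨⟩-cong (∘-resp-≈ˡ (Wk-coherent dΔ w w′)) ≈.refl
  Wk-coherent {Δ , _ ∶ _} (x∉Δ , _) (keep w) (drop w′) = ⊥-elim (proj₁ (∉-Wk w′ x∉Δ) refl)
  Wk-coherent {Δ , _ ∶ _} (x∉Δ , _) (drop w) (keep w′) = ⊥-elim (proj₁ (∉-Wk w x∉Δ) refl)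
  Wk-coherent {Δ , _ ∶ _} dΔ (add• w) (add• w′) = ∘-resp-≈ʳ (Wk-coherent dΔ w w′)
  Wk-coherent {Δ , _ ∶ _} (x∉Δ , dΔ) (drop w) (add• w′) = drop≈add• dΔ x∉Δ w w′
  Wk-coherent {Δ , _ ∶ _} (x∉Δ , dΔ) (add• w′) (drop w) = ≈.sym (drop≈add• dΔ x∉Δ w w′)
  Wk-coherent {Δ ,•} {Ω ,•} dΔ w w′ =
    let v , p = merge•-normal w ; v′ , p′ = merge•-normal w′
    in ≈.trans p (≈.trans (∘-resp-≈ʳ (dia-resp (Wk-coherent dΔ v v′))) (≈.sym p′))

  drop≈add• dΔ x∉Δ w w′ =
    let w″ , p = strengthen w′ (∉-Wk w x∉Δ)
    in ≈.trans (∘-resp-≈ˡ (Wk-coherent dΔ w (add• w″))) (≈.trans assoc (∘-resp-≈ʳ (≈.sym p)))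

  -- Factoring denotations through the common part of two contexts

  record Factor (j : Overlap Δ₁ Δ₂) (f : Hom ⟦ Δ₁ ⟧C X) (g : Hom ⟦ Δ₂ ⟧C X) : Set (ℓ ⊔ e) where
    constructor factor
    field
      mediator     : Hom ⟦ common j ⟧C X
      left-factor  : f ≈ mediator ∘ ⟦ wkˡ j ⟧ʷ
      right-factor : g ≈ mediator ∘ ⟦ wkʳ j ⟧ʷ

  ∘-factor : {j : Overlap Δ₁ Δ₂} (k : Hom X Y) {f : Hom ⟦ Δ₁ ⟧C X} {g : Hom ⟦ Δ₂ ⟧C X} →
             Factor j f g → Factor j (k ∘ f) (k ∘ g)
  ∘-factor k (factor h p q) =
    factor (k ∘ h) (≈.trans (∘-resp-≈ʳ p) (≈.sym assoc)) (≈.trans (∘-resp-≈ʳ q) (≈.sym assoc))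

  ⟨⟩-factor : {j : Overlap Δ₁ Δ₂} {f : Hom ⟦ Δ₁ ⟧C X} {g : Hom ⟦ Δ₂ ⟧C X}
              {f′ : Hom ⟦ Δ₁ ⟧C Y} {g′ : Hom ⟦ Δ₂ ⟧C Y} →
              Factor j f g → Factor j f′ g′ → Factor j ⟨ f , f′ ⟩ ⟨ g , g′ ⟩
  ⟨⟩-factor (factor h p q) (factor h′ p′ q′) =
    factor ⟨ h , h′ ⟩ (≈.trans (⟨⟩-cong p p′) (≈.sym ⟨⟩∘)) (≈.trans (⟨⟩-cong q q′) (≈.sym ⟨⟩∘))

  ∋-factor : (j : Overlap Δ₁ Δ₂) → Apart j → Distinct Δ₁ → Distinct Δ₂ →
             (v₁ : Δ₁ ∋ x ∶ A) (v₂ : Δ₂ ∋ x ∶ A) → Factor j ⟦ v₁ ⟧∋ ⟦ v₂ ⟧∋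
  ∋-factor (both j) _ _ _ here here = factor π₂ (≈.sym π₂-β) (≈.sym π₂-β)
  ∋-factor (both j) _ _ (x∉Δ₂ , _) here (there v₂) = ⊥-elim (∋⇒¬∉ v₂ x∉Δ₂)
  ∋-factor (both j) _ (x∉Δ₁ , _) _ (there v₁) here = ⊥-elim (∋⇒¬∉ v₁ x∉Δ₁)
  ∋-factor (both j) a (_ , dΔ₁) (_ , dΔ₂) (there v₁) (there v₂) =
    let factor h p q = ∋-factor j a dΔ₁ dΔ₂ v₁ v₂
    in factor (h ∘ π₁) (keep-through p) (keep-through q)
  ∋-factor (left j) (x∉Δ₂ , _) _ _ here v₂ = ⊥-elim (∋⇒¬∉ v₂ x∉Δ₂)
  ∋-factor (left j) (_ , a) (_ , dΔ₁) dΔ₂ (there v₁) v₂ =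
    let factor h p q = ∋-factor j a dΔ₁ dΔ₂ v₁ v₂ in factor h (drop-through p) q
  ∋-factor (right j) (x∉Δ₁ , _) _ _ v₁ here = ⊥-elim (∋⇒¬∉ v₁ x∉Δ₁)
  ∋-factor (right j) (_ , a) dΔ₁ (_ , dΔ₂) v₁ (there v₂) =
    let factor h p q = ∋-factor j a dΔ₁ dΔ₂ v₁ v₂ in factor h p (drop-through q)

  curry-through : {f : Hom (⟦ Δ ⟧C ×ₒ X) Y} (h : Hom (⟦ Ω ⟧C ×ₒ X) Y) (u : Wk Δ Ω) →
                  f ≈ h ∘ ⟨ ⟦ u ⟧ʷ ∘ π₁ , π₂ ⟩ → curry f ≈ curry h ∘ ⟦ u ⟧ʷ
  curry-through h u p = ≈.trans (curry-cong p) (≈.sym curry-∘)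

  Ladjunct-through : {f : Hom (Dia ⟦ Δ ⟧C) X} (h : Hom (Dia ⟦ Ω ⟧C) X) (u : Wk Δ Ω) →
                     f ≈ h ∘ ⟦ merge• (add• u) ⟧ʷ → Ladjunct f ≈ Ladjunct h ∘ ⟦ u ⟧ʷ
  Ladjunct-through {Δ = Δ} {Ω = Ω} {f = f} h u p = begin
    box₁ f ∘ ηᵐ ⟦ Δ ⟧C
      ≈⟨ ∘-resp-≈ˡ (box-resp (≈.trans p (∘-resp-≈ʳ (⟦merge•-add•⟧ u)))) ⟩
    box₁ (h ∘ dia₁ ⟦ u ⟧ʷ) ∘ ηᵐ ⟦ Δ ⟧C          ≈⟨ ≈.trans (∘-resp-≈ˡ box-∘) assoc ⟩
    box₁ h ∘ (box₁ (dia₁ ⟦ u ⟧ʷ) ∘ ηᵐ ⟦ Δ ⟧C)  ≈⟨ ∘-resp-≈ʳ (ηᵐ-nat _) ⟩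
    box₁ h ∘ (ηᵐ ⟦ Ω ⟧C ∘ ⟦ u ⟧ʷ)               ≈⟨ assoc ⟨
    (box₁ h ∘ ηᵐ ⟦ Ω ⟧C) ∘ ⟦ u ⟧ʷ               ∎

  lock-coherent : Distinct Δ → (e : Ext P Δ) (u′ : Wk P Ψ) (u : Wk Δ Ω) (w : Wk Ω (Ψ ,•)) →
                  dia₁ ⟦ u′ ⟧ʷ ∘ lock e ≈ ⟦ w ⟧ʷ ∘ ⟦ u ⟧ʷ
  lock-coherent {Δ = Δ} {Ψ = Ψ} dΔ e u′ u w = begin
    dia₁ ⟦ u′ ⟧ʷ ∘ lock e                  ≈⟨ ∘-resp-≈ (⟦merge•-add•⟧ u′) (⟦Ext⇒Wk⟧ e) ⟨
    ⟦ merge• (add• u′) ⟧ʷ ∘ ⟦ Ext⇒Wk e ⟧ʷ  ≈⟨ ⟦Wk-trans⟧ (Ext⇒Wk e) (merge• (add• u′)) ⟨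
    ⟦ through-lock ⟧ʷ                      ≈⟨ Wk-coherent dΔ through-lock (Wk-trans u w) ⟩
    ⟦ Wk-trans u w ⟧ʷ                      ≈⟨ ⟦Wk-trans⟧ u w ⟩
    ⟦ w ⟧ʷ ∘ ⟦ u ⟧ʷ                        ∎
    where
    through-lock : Wk Δ (Ψ ,•)
    through-lock = Wk-trans (Ext⇒Wk e) (merge• (add• u′))

  open-through : Distinct Δ → (e : Ext P Δ) (u′ : Wk P Ψ) (u : Wk Δ Ω) (w : Wk Ω (Ψ ,•)) →
                 {f : Hom ⟦ P ⟧C (Box X)} (h : Hom ⟦ Ψ ⟧C (Box X)) → f ≈ h ∘ ⟦ u′ ⟧ʷ →
                 εᵐ X ∘ (dia₁ f ∘ lock e) ≈ (εᵐ X ∘ (dia₁ h ∘ ⟦ w ⟧ʷ)) ∘ ⟦ u ⟧ʷ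
  open-through {X = X} dΔ e u′ u w {f} h p = begin
    εᵐ X ∘ (dia₁ f ∘ lock e)                   ≈⟨ ∘-resp-≈ʳ (∘-resp-≈ˡ (≈.trans (dia-resp p) dia-∘)) ⟩
    εᵐ X ∘ ((dia₁ h ∘ dia₁ ⟦ u′ ⟧ʷ) ∘ lock e)  ≈⟨ ∘-resp-≈ʳ assoc ⟩
    εᵐ X ∘ (dia₁ h ∘ (dia₁ ⟦ u′ ⟧ʷ ∘ lock e))  ≈⟨ ∘-resp-≈ʳ (∘-resp-≈ʳ (lock-coherent dΔ e u′ u w)) ⟩
    εᵐ X ∘ (dia₁ h ∘ (⟦ w ⟧ʷ ∘ ⟦ u ⟧ʷ))        ≈⟨ ≈.trans (∘-resp-≈ʳ (≈.sym assoc)) (≈.sym assoc) ⟩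
    (εᵐ X ∘ (dia₁ h ∘ ⟦ w ⟧ʷ)) ∘ ⟦ u ⟧ʷ        ∎

  Der-factor : (j : Overlap Δ₁ Δ₂) → Apart j → Distinct Δ₁ → Distinct Δ₂ →
               (D₁ : Der Δ₁ t A) (D₂ : Der Δ₂ t A) → Factor j ⟦ D₁ ⟧ ⟦ D₂ ⟧
  Der-factor j a dΔ₁ dΔ₂ (d-var v₁) (d-var v₂) = ∋-factor j a dΔ₁ dΔ₂ v₁ v₂
  Der-factor j a dΔ₁ dΔ₂ d-unit d-unit = factor ! (≈.sym (!-unique _)) (≈.sym (!-unique _))
  Der-factor j a dΔ₁ dΔ₂ (d-pair s₁ t₁) (d-pair s₂ t₂) =
    ⟨⟩-factor (Der-factor j a dΔ₁ dΔ₂ s₁ s₂) (Der-factor j a dΔ₁ dΔ₂ t₁ t₂)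
  Der-factor j a dΔ₁ dΔ₂ (d-fst t₁) (d-fst t₂)
    with refl ← Der-type-unique j a dΔ₁ dΔ₂ t₁ t₂ = ∘-factor π₁ (Der-factor j a dΔ₁ dΔ₂ t₁ t₂)
  Der-factor j a dΔ₁ dΔ₂ (d-snd t₁) (d-snd t₂)
    with refl ← Der-type-unique j a dΔ₁ dΔ₂ t₁ t₂ = ∘-factor π₂ (Der-factor j a dΔ₁ dΔ₂ t₁ t₂)
  Der-factor j a dΔ₁ dΔ₂ (d-app s₁ t₁) (d-app s₂ t₂)
    with refl ← Der-type-unique j a dΔ₁ dΔ₂ t₁ t₂ =
    ∘-factor eval (⟨⟩-factor (Der-factor j a dΔ₁ dΔ₂ s₁ s₂) (Der-factor j a dΔ₁ dΔ₂ t₁ t₂))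
  Der-factor j a dΔ₁ dΔ₂ (d-lam x∉Δ₁ t₁) (d-lam x∉Δ₂ t₂) =
    let factor h p q = Der-factor (both j) a (x∉Δ₁ , dΔ₁) (x∉Δ₂ , dΔ₂) t₁ t₂
    in factor (curry h) (curry-through h (wkˡ j) p) (curry-through h (wkʳ j) q)
  Der-factor j a dΔ₁ dΔ₂ (d-shut t₁) (d-shut t₂) =
    let factor h p q = Der-factor (both• j) a dΔ₁ dΔ₂ t₁ t₂
    in factor (Ladjunct h) (Ladjunct-through h (wkˡ j) p) (Ladjunct-through h (wkʳ j) q)
  Der-factor j a dΔ₁ dΔ₂ (d-open {A = A} e₁ t₁) (d-open e₂ t₂)
    with j′ , a′ , w ← restrict j a dΔ₁ dΔ₂ e₁ e₂ =
    let factor h p q = Der-factor j′ a′ (Distinct-Ext e₁ dΔ₁) (Distinct-Ext e₂ dΔ₂) t₁ t₂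
    in factor (εᵐ ⟦ A ⟧T ∘ (dia₁ h ∘ ⟦ w ⟧ʷ)) (open-through dΔ₁ e₁ (wkˡ j′) (wkˡ j) w h p)
                                            (open-through dΔ₂ e₂ (wkʳ j′) (wkʳ j) w h q)

  coherence : ∀ Γ → Distinct Γ → (D D′ : Der Γ t A) → ⟦ D ⟧ ≈ ⟦ D′ ⟧
  coherence Γ dΓ D D′ = begin
    ⟦ D ⟧                  ≈⟨ left-factor ⟩
    mediator ∘ ⟦ wkˡ j ⟧ʷ  ≈⟨ ∘-resp-≈ʳ (Wk-coherent dΓ (wkˡ j) (wkʳ j)) ⟩
    mediator ∘ ⟦ wkʳ j ⟧ʷ  ≈⟨ right-factor ⟨
    ⟦ D′ ⟧                 ∎
    where
    j : Overlap Γ Γ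
    j = diagonal Γ
    open Factor (Der-factor j (Apart-diagonal Γ) dΓ dΓ D D′)

theorem8 : ∀ {o ℓ e} (M : Model o ℓ e) → IdempotentComonad M →
    (ρ : ℕ → Model.Obj M) (Γ : Ctx) → Distinct Γ →
    (t : Tm) (A : Ty) (D D′ : Der Γ t A) →
    Model._≈_ M (Sem.⟦_⟧ M ρ D) (Sem.⟦_⟧ M ρ D′)
theorem8 M idem ρ Γ dΓ t A D D′ = Coherence.coherence M idem ρ Γ dΓ D D′
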